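{- For all integers $m$ and $r$ with $1\leq r<m$, $\dim\mathrm{B}_m({\leqslant}r)=\dim\mathrm{B}_m(1,r)$.
   Context: Integers $m$ are identified with $\{0,\dots,m-1\}$ and $\mathfrak{P}(m)$ is its powerset. $\mathrm{B}_m({\leqslant}r):=\{X\in\mathfrak{P}(m): |X|\leq r\text{ or }X=m\}$ and $\mathrm{B}_m(1,r):=\{X\in\mathfrak{P}(m): |X|\in\{1,r\}\}$, both ordered by inclusion. $\dim(P)$, the order-dimension of a poset $P$, is the least number of chains whose product (componentwise order) contains an order-embedded copy of $P$. -}

module Defs where

open import Level using (0ℓ)
open import Data.Nat using (ℕ; _≤_)
open import Data.Fin using (Fin)
open import Data.Fin.Subset using (Subset; _⊆_; ∣_∣; ⊤)
open import Data.Product using (Σ; _×_; proj₁)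
open import Data.Sum using (_⊎_)
open import Relation.Binary.PropositionalEquality using (_≡_)
open import Relation.Binary.Bundles using (TotalOrder)
open import Function.Bundles using (_⇔_)

record Poset′ : Set₁ where
  field
    Carrier : Set
    _≤P_    : Carrier → Carrier → Set

Ble : ℕ → ℕ → Poset′
Ble m r = record
  { Carrier = Σ (Subset m) (λ X → ∣ X ∣ ≤ r ⊎ X ≡ ⊤)
  ; _≤P_    = λ X Y → proj₁ X ⊆ proj₁ Y }

B1r : ℕ → ℕ → Poset′
B1r m r = record
  { Carrier = Σ (Subset m) (λ X → ∣ X ∣ ≡ 1 ⊎ ∣ X ∣ ≡ r)
  ; _≤P_    = λ X Y → proj₁ X ⊆ proj₁ Y }

EmbedsInProduct : (P : Poset′) (k : ℕ) (C : Fin k → TotalOrder 0ℓ 0ℓ 0ℓ) → Set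
EmbedsInProduct P k C =
  Σ (Poset′.Carrier P → (i : Fin k) → TotalOrder.Carrier (C i)) λ f →
    ∀ x y → (Poset′._≤P_ P x y ⇔ (∀ i → TotalOrder._≤_ (C i) (f x i) (f y i)))

EmbedsInChains : Poset′ → ℕ → Set₁
EmbedsInChains P k = Σ (Fin k → TotalOrder 0ℓ 0ℓ 0ℓ) (EmbedsInProduct P k)

IsDim : Poset′ → ℕ → Set₁
IsDim P d = EmbedsInChains P d × (∀ k → EmbedsInChains P k → d ≤ k)

-- B_m(1,r) is a subposet of B_m(≤r), so it embeds in every product of chains that B_m(≤r)
-- embeds in. Conversely, from an embedding f of B_m(1,r) into chains C_i, send a set X with
-- |X| ≤ r to the coordinatewise join of the f{x}, x ∈ X, computed in C_i with a new bottom
-- (the value of ∅), and send m itself to a new top. This reflects inclusion: if x ∉ Y, pad Y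
-- to an r-set R avoiding x; each f{y}, y ∈ Y, lies below f R, so f{x} below the join of Y
-- would force {x} ⊆ R.
--
-- Constructively, a least k such that a poset embeds in k chains needs a decidable stand-in:
-- an embedding of a family of subsets of m into k arbitrary chains can be replaced by ranks
-- in chains of length 2^m + 1, tabulated over all subsets, which can be searched for. The
-- replacement needs the chains' orders to be decidable, which holds only up to double
-- negation; this suffices because the minimality claim d ≤ k is itself decidable.
module Submission where

open import Level using (0ℓ)
open import Data.Nat using (ℕ; zero; suc; _+_; _^_; _≤_; _<_; z≤n; s≤s; _≤?_)
open import Data.Nat.Properties
  using (+-mono-≤; +-mono-<-≤; +-mono-≤-<; +-identityʳ; ≤-refl; ≤-trans; ≤-reflexive; ≤-pred; ≰⇒>;
         ≤-<-trans; <⇒≱; ≮⇒≥; anyUpTo?)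
open import Data.Nat.Induction using (<-rec)
import Data.Bool as Bool
import Data.Bool.Properties as Boolₚ
open import Data.Fin using (Fin; zero; suc; toℕ; fromℕ<)
import Data.Fin as Fin
import Data.Fin.Properties as Finₚ
open import Data.Fin.Subset using (Subset; outside; inside; _⊆_; _∈_; _∉_; ∣_∣; ∁; ⁅_⁆; ⊤; ⊥)
open import Data.Fin.Subset.Properties
  using (_∈?_; _⊆?_; anySubset?; drop-∷-⊆; out⊆; s⊆s; p⊆q⇒∣p∣≤∣q∣; ∣∁p∣≡n∸∣p∣; ∣⁅x⁆∣≡1; ∣⊤∣≡n;
         ∣⊥∣≡0; x∈⁅x⁆; x∈⁅y⁆⇒x≡y; x∉p⇒x∈∁p; x∈p⇒x∉∁p; ∈⊤)
open import Data.Vec using (Vec; []; _∷_; here; there; lookup; tabulate)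
open import Data.Vec.Properties using (lookup∘tabulate; ≡-dec)
open import Data.Product using (Σ; ∃; _×_; _,_; proj₁; proj₂)
open import Data.Sum using (_⊎_; inj₁; inj₂)
open import Data.Empty using (⊥-elim)
open import Function using (_∘_)
open import Function.Bundles using (_⇔_; mk⇔; Equivalence)
open import Function.Construct.Composition using (_⇔-∘_)
open import Function.Construct.Identity using (⇔-id)
open import Relation.Nullary using (¬_; Dec; yes; no; ¬?; _×-dec_; _⊎-dec_; _→-dec_)
open import Relation.Nullary.Decidable using (map′; decidable-stable; ¬¬-excluded-middle)
open import Relation.Nullary.Negation using (¬¬-map)
open import Relation.Nullary.Construct.Add.Point using ([_])
open import Relation.Nullary.Construct.Add.Supremum using (⊤⁺)
open import Relation.Unary using (Pred; Decidable)
open import Relation.Binary.Bundles using (TotalOrder)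
open import Relation.Binary.Definitions using (Minimum)
open import Relation.Binary.PropositionalEquality using (_≡_; refl; sym; cong; subst; subst₂)
open import Relation.Binary.PropositionalEquality.Properties using (module ≡-Reasoning)
import Relation.Binary.Properties.TotalOrder as TotalOrderₚ
import Relation.Binary.Construct.Add.Infimum.NonStrict as AddInfimum
import Relation.Binary.Construct.Add.Supremum.NonStrict as AddSupremum
import Algebra.Construct.NaturalChoice.Max as Max
open import Defs

count : ∀ {n} {P : Pred (Subset n) 0ℓ} → Decidable P → ℕ
count {zero} P? with P? []
... | yes _ = 1
... | no _  = 0
count {suc n} P? = count (P? ∘ (outside ∷_)) + count (P? ∘ (inside ∷_))

count≤2^n : ∀ {n} {P : Pred (Subset n) 0ℓ} (P? : Decidable P) → count P? ≤ 2 ^ n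
count≤2^n {zero} P? with P? []
... | yes _ = ≤-refl
... | no _  = z≤n
count≤2^n {suc n} P? rewrite +-identityʳ (2 ^ n) =
  +-mono-≤ (count≤2^n (P? ∘ (outside ∷_))) (count≤2^n (P? ∘ (inside ∷_)))

count-mono : ∀ {n} {P Q : Pred (Subset n) 0ℓ} (P? : Decidable P) (Q? : Decidable Q) →
             (∀ {Z} → P Z → Q Z) → count P? ≤ count Q?
count-mono {zero} P? Q? P⇒Q with P? [] | Q? []
... | no _  | _     = z≤n
... | yes _ | yes _ = ≤-refl
... | yes p | no ¬q = ⊥-elim (¬q (P⇒Q p))
count-mono {suc n} P? Q? P⇒Q =
  +-mono-≤ (count-mono (P? ∘ (outside ∷_)) (Q? ∘ (outside ∷_)) P⇒Q)
           (count-mono (P? ∘ (inside ∷_)) (Q? ∘ (inside ∷_)) P⇒Q)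

count-mono-< : ∀ {n} {P Q : Pred (Subset n) 0ℓ} (P? : Decidable P) (Q? : Decidable Q) →
               (∀ {Z} → P Z → Q Z) → ∀ Z → Q Z → ¬ P Z → count P? < count Q?
count-mono-< {zero} P? Q? P⇒Q [] q ¬p with P? [] | Q? []
... | yes p | _     = ⊥-elim (¬p p)
... | no _  | yes _ = ≤-refl
... | no _  | no ¬q = ⊥-elim (¬q q)
count-mono-< {suc n} P? Q? P⇒Q (outside ∷ Z) q ¬p =
  +-mono-<-≤ (count-mono-< (P? ∘ (outside ∷_)) (Q? ∘ (outside ∷_)) P⇒Q Z q ¬p)
             (count-mono (P? ∘ (inside ∷_)) (Q? ∘ (inside ∷_)) P⇒Q)
count-mono-< {suc n} P? Q? P⇒Q (inside ∷ Z) q ¬p =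
  +-mono-≤-< (count-mono (P? ∘ (outside ∷_)) (Q? ∘ (outside ∷_)) P⇒Q)
             (count-mono-< (P? ∘ (inside ∷_)) (Q? ∘ (inside ∷_)) P⇒Q Z q ¬p)

x∈p⇒⁅x⁆⊆p : ∀ {n} {x : Fin n} {p : Subset n} → x ∈ p → ⁅ x ⁆ ⊆ p
x∈p⇒⁅x⁆⊆p {x = x} {p} x∈p y∈⁅x⁆ = subst (_∈ p) (sym (x∈⁅y⁆⇒x≡y x y∈⁅x⁆)) x∈p

∣p∣<n⇒⊤⊈p : ∀ {n} {p : Subset n} → ∣ p ∣ < n → ¬ (⊤ ⊆ p)
∣p∣<n⇒⊤⊈p {n} ∣p∣<n ⊤⊆p =
  <⇒≱ ∣p∣<n (≤-trans (≤-reflexive (sym (∣⊤∣≡n n))) (p⊆q⇒∣p∣≤∣q∣ ⊤⊆p))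

⊆-between : ∀ {n} {Y Z : Subset n} r → Y ⊆ Z → ∣ Y ∣ ≤ r → r ≤ ∣ Z ∣ →
            ∃ λ R → Y ⊆ R × R ⊆ Z × ∣ R ∣ ≡ r
⊆-between {Y = []} {[]} zero _ _ _ = [] , (λ ()) , (λ ()) , refl
⊆-between {Y = outside ∷ Y} {outside ∷ Z} r Y⊆Z Y≤r r≤Z
  with R , Y⊆R , R⊆Z , ∣R∣≡r ← ⊆-between r (drop-∷-⊆ Y⊆Z) Y≤r r≤Z
  = outside ∷ R , s⊆s Y⊆R , s⊆s R⊆Z , ∣R∣≡r
⊆-between {Y = inside ∷ Y} {outside ∷ Z} r Y⊆Z Y≤r r≤Z with () ← Y⊆Z here
⊆-between {Y = inside ∷ Y} {inside ∷ Z} (suc r) Y⊆Z (s≤s Y≤r) (s≤s r≤Z)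
  with R , Y⊆R , R⊆Z , ∣R∣≡r ← ⊆-between r (drop-∷-⊆ Y⊆Z) Y≤r r≤Z
  = inside ∷ R , s⊆s Y⊆R , s⊆s R⊆Z , cong suc ∣R∣≡r
⊆-between {Y = outside ∷ Y} {inside ∷ Z} r Y⊆Z Y≤r r≤Z with r ≤? ∣ Z ∣
... | yes r≤∣Z∣
  with R , Y⊆R , R⊆Z , ∣R∣≡r ← ⊆-between r (drop-∷-⊆ Y⊆Z) Y≤r r≤∣Z∣
  = outside ∷ R , s⊆s Y⊆R , out⊆ R⊆Z , ∣R∣≡r
⊆-between {Y = outside ∷ Y} {inside ∷ Z} zero Y⊆Z Y≤r r≤Z | no 0≰∣Z∣ = ⊥-elim (0≰∣Z∣ z≤n)
⊆-between {Y = outside ∷ Y} {inside ∷ Z} (suc r) Y⊆Z Y≤r (s≤s r≤Z) | no r+1≰∣Z∣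
  with R , Y⊆R , R⊆Z , ∣R∣≡r ← ⊆-between r (drop-∷-⊆ Y⊆Z)
         (≤-trans (p⊆q⇒∣p∣≤∣q∣ (drop-∷-⊆ Y⊆Z)) (≤-pred (≰⇒> r+1≰∣Z∣))) r≤Z
  = inside ∷ R , out⊆ Y⊆R , s⊆s R⊆Z , cong suc ∣R∣≡r

∃-superset-avoiding : ∀ {m r} {Y : Subset m} {x} → r < m → ∣ Y ∣ ≤ r → x ∉ Y →
                      ∃ λ R → Y ⊆ R × x ∉ R × ∣ R ∣ ≡ r
∃-superset-avoiding {suc m} {r} {Y} {x} (s≤s r≤m) Y≤r x∉Y =
  avoid (⊆-between r Y⊆∁⁅x⁆ Y≤r r≤∣∁⁅x⁆∣)
  where
  Y⊆∁⁅x⁆ : Y ⊆ ∁ ⁅ x ⁆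
  Y⊆∁⁅x⁆ {y} y∈Y = x∉p⇒x∈∁p λ y∈⁅x⁆ → x∉Y (subst (_∈ Y) (x∈⁅y⁆⇒x≡y x y∈⁅x⁆) y∈Y)
  r≤∣∁⁅x⁆∣ : r ≤ ∣ ∁ ⁅ x ⁆ ∣
  r≤∣∁⁅x⁆∣ rewrite ∣∁p∣≡n∸∣p∣ ⁅ x ⁆ | ∣⁅x⁆∣≡1 x = r≤m
  avoid : (∃ λ R → Y ⊆ R × R ⊆ ∁ ⁅ x ⁆ × ∣ R ∣ ≡ r) → ∃ λ R → Y ⊆ R × x ∉ R × ∣ R ∣ ≡ r
  avoid (R , Y⊆R , R⊆∁⁅x⁆ , ∣R∣≡r) =
    R , Y⊆R , (λ x∈R → x∈p⇒x∉∁p (x∈⁅x⁆ x) (R⊆∁⁅x⁆ x∈R)) , ∣R∣≡r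

⊆⇒lookup-≤ : ∀ {n} {X Y : Subset n} → X ⊆ Y → ∀ i → lookup X i Bool.≤ lookup Y i
⊆⇒lookup-≤ {X = outside ∷ X} {y ∷ Y}       X⊆Y zero    = Boolₚ.≤-minimum y
⊆⇒lookup-≤ {X = inside ∷ X}  {inside ∷ Y}  X⊆Y zero    = Boolₚ.≤-refl
⊆⇒lookup-≤ {X = inside ∷ X}  {outside ∷ Y} X⊆Y zero    with () ← X⊆Y here
⊆⇒lookup-≤ {X = x ∷ X}       {y ∷ Y}       X⊆Y (suc i) = ⊆⇒lookup-≤ (drop-∷-⊆ X⊆Y) i

lookup-≤⇒⊆ : ∀ {n} {X Y : Subset n} → (∀ i → lookup X i Bool.≤ lookup Y i) → X ⊆ Y
lookup-≤⇒⊆ {Y = inside ∷ Y}  X≤Y here        = here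
lookup-≤⇒⊆ {Y = outside ∷ Y} X≤Y here        with () ← X≤Y zero
lookup-≤⇒⊆ {Y = y ∷ Y}       X≤Y (there x∈X) = there (lookup-≤⇒⊆ (X≤Y ∘ suc) x∈X)

Searchable : Set → Set₁
Searchable A = ∀ {P : Pred A 0ℓ} → Decidable P → Dec (∃ P)

searchable-Fin : ∀ {n} → Searchable (Fin n)
searchable-Fin = Finₚ.any?

searchable-× : ∀ {A B} → Searchable A → Searchable B → Searchable (A × B)
searchable-× search-A search-B P? =
  map′ (λ (a , b , p) → (a , b) , p) (λ ((a , b) , p) → a , b , p)
       (search-A λ a → search-B λ b → P? (a , b))

searchable-Vec : ∀ {A n} → Searchable A → Searchable (Vec A n)
searchable-Vec {n = zero} search-A P? = map′ ([] ,_) (λ { ([] , p) → p }) (P? [])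
searchable-Vec {n = suc n} search-A P? =
  map′ (λ ((x , xs) , p) → x ∷ xs , p) (λ { (x ∷ xs , p) → (x , xs) , p })
       (searchable-× search-A (searchable-Vec search-A) λ (x , xs) → P? (x ∷ xs))

-- A first-order representation of functions Subset n → B, so that they can be searched.
Trie : Set → ℕ → Set
Trie B zero    = B
Trie B (suc n) = Trie B n × Trie B n

lookupᵀ : ∀ {B n} → Trie B n → Subset n → B
lookupᵀ {n = zero}  b       []            = b
lookupᵀ {n = suc n} (t , _) (outside ∷ X) = lookupᵀ t X
lookupᵀ {n = suc n} (_ , t) (inside ∷ X)  = lookupᵀ t X

tabulateᵀ : ∀ {B n} → (Subset n → B) → Trie B n
tabulateᵀ {n = zero}  g = g []
tabulateᵀ {n = suc n} g = tabulateᵀ (g ∘ (outside ∷_)) , tabulateᵀ (g ∘ (inside ∷_))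

lookupᵀ∘tabulateᵀ : ∀ {B n} (g : Subset n → B) X → lookupᵀ (tabulateᵀ g) X ≡ g X
lookupᵀ∘tabulateᵀ {n = zero}  g []            = refl
lookupᵀ∘tabulateᵀ {n = suc n} g (outside ∷ X) = lookupᵀ∘tabulateᵀ (g ∘ (outside ∷_)) X
lookupᵀ∘tabulateᵀ {n = suc n} g (inside ∷ X)  = lookupᵀ∘tabulateᵀ (g ∘ (inside ∷_)) X

searchable-Trie : ∀ {B n} → Searchable B → Searchable (Trie B n)
searchable-Trie {n = zero}  search-B = search-B
searchable-Trie {n = suc n} search-B =
  searchable-× (searchable-Trie search-B) (searchable-Trie search-B)

allSubsets? : ∀ {n} {P : Pred (Subset n) 0ℓ} → Decidable P → Dec (∀ X → P X)
allSubsets? P? with anySubset? (¬? ∘ P?)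
... | yes (X , ¬PX) = no λ ∀P → ¬PX (∀P X)
... | no ¬∃¬P       = yes λ X → decidable-stable (P? X) λ ¬PX → ¬∃¬P (X , ¬PX)

_⇔?_ : ∀ {A B : Set} → Dec A → Dec B → Dec (A ⇔ B)
A? ⇔? B? = map′ (λ (f , g) → mk⇔ f g) (λ A⇔B → Equivalence.to A⇔B , Equivalence.from A⇔B)
                ((A? →-dec B?) ×-dec (B? →-dec A?))

¬¬-∀-Fin : ∀ {n} {P : Pred (Fin n) 0ℓ} → (∀ i → ¬ ¬ P i) → ¬ ¬ (∀ i → P i)
¬¬-∀-Fin {zero}  _   ¬∀P = ¬∀P λ ()
¬¬-∀-Fin {suc n} ¬¬P ¬∀P =
  ¬¬P zero λ P0 → ¬¬-∀-Fin (¬¬P ∘ suc) λ Psuc → ¬∀P λ { zero → P0 ; (suc i) → Psuc i }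

¬¬-∀-Subset : ∀ {n} {P : Pred (Subset n) 0ℓ} → (∀ X → ¬ ¬ P X) → ¬ ¬ (∀ X → P X)
¬¬-∀-Subset {zero}  ¬¬P ¬∀P = ¬¬P [] λ P[] → ¬∀P λ { [] → P[] }
¬¬-∀-Subset {suc n} ¬¬P ¬∀P =
  ¬¬-∀-Subset (¬¬P ∘ (outside ∷_)) λ Pout →
  ¬¬-∀-Subset (¬¬P ∘ (inside ∷_)) λ Pin →
  ¬∀P λ { (outside ∷ X) → Pout X ; (inside ∷ X) → Pin X }

Least : ∀ {ℓ} → (ℕ → Set ℓ) → Set ℓ
Least P = Σ ℕ λ d → P d × (∀ k → P k → d ≤ k)

least-witness : ∀ {P : Pred ℕ 0ℓ} → Decidable P → ∀ {n} → P n → Least P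
least-witness {P} P? {n} = <-rec (λ n → P n → Least P) step n
  where
  step : ∀ n → (∀ {j} → j < n → P j → Least P) → P n → Least P
  step n rec Pn with anyUpTo? P? n
  ... | yes (j , j<n , Pj) = rec j<n Pj
  ... | no ¬∃j<n           = n , Pn , λ k Pk → ≮⇒≥ λ k<n → ¬∃j<n (k , k<n , Pk)

least-of-¬¬-equivalent : ∀ {E : ℕ → Set₁} {Q : Pred ℕ 0ℓ} → Decidable Q →
                         (∀ {k} → Q k → E k) → (∀ {k} → E k → ¬ ¬ Q k) →
                         ∀ {n} → E n → Least E
least-of-¬¬-equivalent Q? Q⇒E E⇒¬¬Q {n} En
  with d , Qd , d-least ← least-witness Q? (decidable-stable (Q? n) (E⇒¬¬Q En))
  = d , Q⇒E Qd , λ k Ek → decidable-stable (d ≤? k) (¬¬-map (d-least k) (E⇒¬¬Q Ek))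

withBottom : TotalOrder 0ℓ 0ℓ 0ℓ → TotalOrder 0ℓ 0ℓ 0ℓ
withBottom C = record
  { isTotalOrder = AddInfimum.≤₋-isTotalOrder (TotalOrder._≤_ C) (TotalOrder.isTotalOrder C) }

withTop : TotalOrder 0ℓ 0ℓ 0ℓ → TotalOrder 0ℓ 0ℓ 0ℓ
withTop C = record
  { isTotalOrder = AddSupremum.≤⁺-isTotalOrder (TotalOrder._≤_ C) (TotalOrder.isTotalOrder C) }

module Join (O : TotalOrder 0ℓ 0ℓ 0ℓ) {bot : TotalOrder.Carrier O}
            (bot-minimum : Minimum (TotalOrder._≤_ O) bot) where
  open TotalOrder O using (Carrier; trans) renaming (_≤_ to _≼_)
  open Max O using (_⊔_; x≤x⊔y; x≤y⊔x; ⊔-lub)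

  ⨆ : ∀ {n} → Subset n → (Fin n → Carrier) → Carrier
  ⨆ []            s = bot
  ⨆ (outside ∷ X) s = ⨆ X (s ∘ suc)
  ⨆ (inside ∷ X)  s = s zero ⊔ ⨆ X (s ∘ suc)

  ⨆-upper : ∀ {n} {X : Subset n} {s j} → j ∈ X → s j ≼ ⨆ X s
  ⨆-upper {X = inside ∷ X}  {s} here        = x≤x⊔y (s zero) (⨆ X (s ∘ suc))
  ⨆-upper {X = outside ∷ X}     (there j∈X) = ⨆-upper j∈X
  ⨆-upper {X = inside ∷ X}  {s} (there j∈X) =
    trans (⨆-upper {s = s ∘ suc} j∈X) (x≤y⊔x (s zero) (⨆ X (s ∘ suc)))

  ⨆-least : ∀ {n} {X : Subset n} {s z} → (∀ {j} → j ∈ X → s j ≼ z) → ⨆ X s ≼ z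
  ⨆-least {X = []}          s≤z = bot-minimum _
  ⨆-least {X = outside ∷ X} s≤z = ⨆-least (s≤z ∘ there)
  ⨆-least {X = inside ∷ X}  s≤z = ⊔-lub (s≤z here) (⨆-least (s≤z ∘ there))

EmbedsInChains-reflect : ∀ {P Q k} (h : Poset′.Carrier P → Poset′.Carrier Q) →
  (∀ x y → Poset′._≤P_ P x y ⇔ Poset′._≤P_ Q (h x) (h y)) →
  EmbedsInChains Q k → EmbedsInChains P k
EmbedsInChains-reflect h h-embedding (C , f , f-embedding) =
  C , f ∘ h , λ x y → f-embedding (h x) (h y) ⇔-∘ h-embedding x y

InclusionOrder : ∀ {m} → Pred (Subset m) 0ℓ → Poset′
InclusionOrder {m} F = record
  { Carrier = Σ (Subset m) F
  ; _≤P_    = λ X Y → proj₁ X ⊆ proj₁ Y }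

characteristic-embedding : ∀ {m} (F : Pred (Subset m) 0ℓ) → EmbedsInChains (InclusionOrder F) m
characteristic-embedding F =
  (λ _ → Boolₚ.≤-totalOrder) , (λ X → lookup (proj₁ X)) , λ X Y → mk⇔ ⊆⇒lookup-≤ lookup-≤⇒⊆

module Compression {m} {F : Pred (Subset m) 0ℓ} (F? : Decidable F) {X₀ : Subset m} (F₀ : F X₀) where

  Rank : Set
  Rank = Fin (suc (2 ^ m))

  IsRankEmbedding : ∀ {k} → Vec (Trie Rank m) k → Set
  IsRankEmbedding ts = ∀ X Y → F X → F Y →
    X ⊆ Y ⇔ (∀ i → lookupᵀ (lookup ts i) X Fin.≤ lookupᵀ (lookup ts i) Y)

  RankEmbedding : ℕ → Set
  RankEmbedding k = ∃ (IsRankEmbedding {k})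

  rankEmbedding? : Decidable RankEmbedding
  rankEmbedding? k = searchable-Vec (searchable-Trie searchable-Fin) λ ts →
    allSubsets? λ X → allSubsets? λ Y → F? X →-dec F? Y →-dec
      (X ⊆? Y) ⇔? Finₚ.all? λ i → lookupᵀ (lookup ts i) X Finₚ.≤? lookupᵀ (lookup ts i) Y

  rankEmbedding⇒embeds : ∀ {k} → RankEmbedding k → EmbedsInChains (InclusionOrder F) k
  rankEmbedding⇒embeds (ts , ts-embedding) =
    (λ _ → Finₚ.≤-totalOrder _) , (λ X i → lookupᵀ (lookup ts i) (proj₁ X)) ,
    λ (X , FX) (Y , FY) → ts-embedding X Y FX FY

  module _ {k} (C : Fin k → TotalOrder 0ℓ 0ℓ 0ℓ) (E : EmbedsInProduct (InclusionOrder F) k C) where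
    open Poset′ (InclusionOrder F) using (Carrier)
    module C i = TotalOrder (C i)

    -- Subsets outside the family get the junk value of X₀.
    rep : Subset m → Carrier
    rep X with F? X
    ... | yes FX = X , FX
    ... | no _   = X₀ , F₀

    rep-proj : ∀ {X} → F X → proj₁ (rep X) ≡ X
    rep-proj {X} FX with F? X
    ... | yes _  = refl
    ... | no ¬FX = ⊥-elim (¬FX FX)

    φ : Subset m → (i : Fin k) → C.Carrier i
    φ X = proj₁ E (rep X)

    φ-embedding : ∀ {X Y} → F X → F Y → X ⊆ Y ⇔ (∀ i → C._≤_ i (φ X i) (φ Y i))
    φ-embedding {X} {Y} FX FY =
      subst₂ (λ A B → A ⊆ B ⇔ (∀ i → C._≤_ i (φ X i) (φ Y i))) (rep-proj FX) (rep-proj FY)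
             (proj₂ E (rep X) (rep Y))

    module _ (_≤?_ : ∀ i X Y → Dec (C._≤_ i (φ X i) (φ Y i))) where

      below : ∀ i X → Decidable (λ Z → F Z × C._≤_ i (φ Z i) (φ X i))
      below i X Z = F? Z ×-dec (i ≤? Z) X

      rank : Fin k → Subset m → ℕ
      rank i X = count (below i X)

      rank-mono : ∀ {i X Y} → C._≤_ i (φ X i) (φ Y i) → rank i X ≤ rank i Y
      rank-mono {i} {X} {Y} X≤Y =
        count-mono (below i X) (below i Y) λ (FZ , Z≤X) → FZ , C.trans i Z≤X X≤Y

      rank-reflects : ∀ {i X Y} → F X → rank i X ≤ rank i Y → C._≤_ i (φ X i) (φ Y i)
      rank-reflects {i} {X} {Y} FX rX≤rY with (i ≤? X) Y
      ... | yes X≤Y = X≤Y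
      ... | no X≰Y  = ⊥-elim (<⇒≱ rY<rX rX≤rY)
        where
        Y≤X : C._≤_ i (φ Y i) (φ X i)
        Y≤X = TotalOrderₚ.≰⇒≥ (C i) X≰Y
        rY<rX : rank i Y < rank i X
        rY<rX = count-mono-< (below i Y) (below i X) (λ (FZ , Z≤Y) → FZ , C.trans i Z≤Y Y≤X)
                             X (FX , C.refl i) (X≰Y ∘ proj₂)

      rankᶠ : Fin k → Subset m → Rank
      rankᶠ i X = fromℕ< (s≤s (count≤2^n (below i X)))

      ranks : Vec (Trie Rank m) k
      ranks = tabulate λ i → tabulateᵀ (rankᶠ i)

      toℕ-ranks : ∀ i X → toℕ (lookupᵀ (lookup ranks i) X) ≡ rank i X
      toℕ-ranks i X = begin
        toℕ (lookupᵀ (lookup ranks i) X)      ≡⟨ cong (λ t → toℕ (lookupᵀ t X)) (lookup∘tabulate _ i) ⟩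
        toℕ (lookupᵀ (tabulateᵀ (rankᶠ i)) X) ≡⟨ cong toℕ (lookupᵀ∘tabulateᵀ (rankᶠ i) X) ⟩
        toℕ (rankᶠ i X)                       ≡⟨ Finₚ.toℕ-fromℕ< _ ⟩
        rank i X                              ∎
        where open ≡-Reasoning

      ranks-embedding : IsRankEmbedding ranks
      ranks-embedding X Y FX FY = mk⇔
        (λ φX≤φY i → subst₂ _≤_ (sym (toℕ-ranks i X)) (sym (toℕ-ranks i Y)) (rank-mono (φX≤φY i)))
        (λ rX≤rY i → rank-reflects FX (subst₂ _≤_ (toℕ-ranks i X) (toℕ-ranks i Y) (rX≤rY i)))
        ⇔-∘ φ-embedding FX FY

  embeds⇒¬¬rankEmbedding : ∀ {k} → EmbedsInChains (InclusionOrder F) k → ¬ ¬ RankEmbedding k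
  embeds⇒¬¬rankEmbedding (C , E) =
    ¬¬-map (λ ≤? → ranks C E ≤? , ranks-embedding C E ≤?)
           (¬¬-∀-Fin λ i → ¬¬-∀-Subset λ X → ¬¬-∀-Subset λ Y → ¬¬-excluded-middle)

  dimension-exists : Σ ℕ (IsDim (InclusionOrder F))
  dimension-exists = least-of-¬¬-equivalent rankEmbedding? rankEmbedding⇒embeds
                       embeds⇒¬¬rankEmbedding (characteristic-embedding F)

Ble-member? : ∀ {m r} → Decidable (λ (X : Subset m) → ∣ X ∣ ≤ r ⊎ X ≡ ⊤)
Ble-member? {r = r} X = (∣ X ∣ ≤? r) ⊎-dec ≡-dec Boolₚ._≟_ X ⊤

Ble-embeds⇒B1r-embeds : ∀ {m r k} → 1 ≤ r → EmbedsInChains (Ble m r) k → EmbedsInChains (B1r m r) k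
Ble-embeds⇒B1r-embeds {m} {r} 1≤r = EmbedsInChains-reflect (λ (X , s) → X , small s) λ _ _ → ⇔-id _
  where
  small : ∀ {X : Subset m} → ∣ X ∣ ≡ 1 ⊎ ∣ X ∣ ≡ r → ∣ X ∣ ≤ r ⊎ X ≡ ⊤
  small (inj₁ ∣X∣≡1) = inj₁ (subst (_≤ r) (sym ∣X∣≡1) 1≤r)
  small (inj₂ ∣X∣≡r) = inj₁ (≤-reflexive ∣X∣≡r)

module B1r⇒Ble {m r} (r<m : r < m) {k} (C : Fin k → TotalOrder 0ℓ 0ℓ 0ℓ)
               (E : EmbedsInProduct (B1r m r) k C) where
  open Poset′ using (Carrier)
  module C₋ i = TotalOrder (withBottom (C i))
  module ⨆ i = Join (withBottom (C i)) (AddInfimum.≤₋-minimum (TotalOrder._≤_ (C i)))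

  C± : Fin k → TotalOrder 0ℓ 0ℓ 0ℓ
  C± i = withTop (withBottom (C i))

  f : Carrier (B1r m r) → (i : Fin k) → TotalOrder.Carrier (C i)
  f = proj₁ E

  singleton : Fin m → Carrier (B1r m r)
  singleton j = ⁅ j ⁆ , inj₁ (∣⁅x⁆∣≡1 j)

  ⨆f : Subset m → (i : Fin k) → C₋.Carrier i
  ⨆f X i = ⨆.⨆ i X λ j → [ f (singleton j) i ]

  ⨆f-upper : ∀ {x X} → x ∈ X → ∀ i → C₋._≤_ i [ f (singleton x) i ] (⨆f X i)
  ⨆f-upper x∈X i = ⨆.⨆-upper i {s = λ j → [ f (singleton j) i ]} x∈X

  ⨆f-mono : ∀ {X Y} → X ⊆ Y → ∀ i → C₋._≤_ i (⨆f X i) (⨆f Y i)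
  ⨆f-mono X⊆Y i = ⨆.⨆-least i λ j∈X → ⨆f-upper (X⊆Y j∈X) i

  ⨆f-below : ∀ {Y} (R : Carrier (B1r m r)) → Y ⊆ proj₁ R → ∀ i → C₋._≤_ i (⨆f Y i) [ f R i ]
  ⨆f-below R Y⊆R i = ⨆.⨆-least i λ j∈Y →
    AddInfimum.[_] (Equivalence.to (proj₂ E (singleton _) R) (x∈p⇒⁅x⁆⊆p (Y⊆R j∈Y)) i)

  ∈-if-below-⨆f : ∀ {x Y} → ∣ Y ∣ ≤ r → (∀ i → C₋._≤_ i [ f (singleton x) i ] (⨆f Y i)) → x ∈ Y
  ∈-if-below-⨆f {x} {Y} Y≤r x≤Y with x ∈? Y
  ... | yes x∈Y = x∈Y
  ... | no x∉Y =
    let R , Y⊆R , x∉R , ∣R∣≡r = ∃-superset-avoiding r<m Y≤r x∉Y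
        R′ : Carrier (B1r m r)
        R′ = R , inj₂ ∣R∣≡r
        x≤R : ∀ i → TotalOrder._≤_ (C i) (f (singleton x) i) (f R′ i)
        x≤R i = AddInfimum.[≤]-injective _ (C₋.trans i (x≤Y i) (⨆f-below R′ Y⊆R i))
    in ⊥-elim (x∉R (Equivalence.from (proj₂ E (singleton x) R′) x≤R (x∈⁅x⁆ x)))

  g : Carrier (Ble m r) → (i : Fin k) → TotalOrder.Carrier (C± i)
  g (X , inj₁ _) i = [ ⨆f X i ]
  g (X , inj₂ _) i = ⊤⁺

  g-embedding : ∀ X Y → proj₁ X ⊆ proj₁ Y ⇔ (∀ i → TotalOrder._≤_ (C± i) (g X i) (g Y i))
  g-embedding X (Y , inj₂ Y≡⊤) =
    mk⇔ (λ _ i → g X i AddSupremum.≤⊤⁺) (λ _ {x} _ → subst (x ∈_) (sym Y≡⊤) ∈⊤)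
  g-embedding (X , inj₁ _) (Y , inj₁ Y≤r) = mk⇔
    (λ (X⊆Y : X ⊆ Y) i → AddSupremum.[_] (⨆f-mono {X} {Y} X⊆Y i))
    (λ X≤Y x∈X → ∈-if-below-⨆f Y≤r λ i →
       C₋.trans i (⨆f-upper x∈X i) (AddSupremum.[≤]-injective _ (X≤Y i)))
  g-embedding (X , inj₂ X≡⊤) (Y , inj₁ Y≤r) = mk⇔
    (λ (X⊆Y : X ⊆ Y) → ⊥-elim (∣p∣<n⇒⊤⊈p (≤-<-trans Y≤r r<m) (subst (_⊆ Y) X≡⊤ X⊆Y)))
    (λ ⊤≤Y _ → ∈-if-below-⨆f Y≤r λ i → ⊥-elim (⊤⁺≰[_] (⊤≤Y i)))
    where
    ⊤⁺≰[_] : ∀ {i x} → ¬ TotalOrder._≤_ (C± i) ⊤⁺ [ x ]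
    ⊤⁺≰[_] ()

  embedding : EmbedsInChains (Ble m r) k
  embedding = C± , g , g-embedding

lemma5p6 : (m r : ℕ) → 1 ≤ r → r < m →
    Σ ℕ (λ d → IsDim (Ble m r) d × IsDim (B1r m r) d)
lemma5p6 m r 1≤r r<m =
  let ∅∈Ble = inj₁ (subst (_≤ r) (sym (∣⊥∣≡0 m)) z≤n)
      d , Ble-embeds , Ble-minimal = Compression.dimension-exists (Ble-member? {m} {r}) {⊥} ∅∈Ble
  in d , (Ble-embeds , Ble-minimal) ,
     (Ble-embeds⇒B1r-embeds 1≤r Ble-embeds ,
      λ k (C , E) → Ble-minimal k (B1r⇒Ble.embedding r<m C E))
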